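{- Let $r\ge 2$ be an integer. Every $r$-free digraph $G$ on $n$ vertices satisfies $\beta(G) \le 25n^2/r^2$.
   Context: A digraph has a finite vertex set and a set of ordered pairs of vertices (edges), with no loops or parallel edges. A directed cycle of length $\ell\ge 2$ consists of distinct vertices $v_1,\dots,v_\ell$ with edges $(v_i,v_{i+1})$, $1\le i<\ell$, and $(v_\ell,v_1)$. For $r\ge 2$, a digraph is $r$-free if it has no directed cycle of length at most $r$. $\beta(G)$ is the minimum number of edges whose deletion leaves a digraph with no directed cycles. -}

module Defs where

open import Data.Nat using (ℕ; zero; suc; _+_; _*_; _≤_)
open import Data.Bool using (Bool; true; false; _∧_; not)
open import Data.Fin using (Fin)
open import Data.Fin.Properties using ()
open import Data.List using (List; []; _∷_; length)
open import Data.List.Base using (allFin)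
open import Data.List.Relation.Unary.Unique.Propositional using (Unique)
open import Data.Product using (Σ; _×_; ∃)
open import Relation.Binary.PropositionalEquality using (_≡_)
open import Relation.Nullary using (¬_)

-- Parallel edges are
-- impossible in this encoding; loops are excluded by the Digraph record.
record Digraph (n : ℕ) : Set where
  field
    edge   : Fin n → Fin n → Bool
    noLoop : ∀ v → edge v v ≡ false
open Digraph public

EdgeRel : ℕ → Set
EdgeRel n = Fin n → Fin n → Bool

PathEdges : ∀ {n} → EdgeRel n → List (Fin n) → Set
PathEdges E []            = Data.Unit.⊤
  where import Data.Unit
PathEdges E (x ∷ [])      = Data.Unit.⊤
  where import Data.Unit
PathEdges E (x ∷ y ∷ xs)  = (E x y ≡ true) × PathEdges E (y ∷ xs)

lastOf : ∀ {A : Set} → A → List A → A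
lastOf a []       = a
lastOf a (b ∷ bs) = lastOf b bs

record DirectedCycle {n : ℕ} (E : EdgeRel n) (ℓ : ℕ) : Set where
  field
    v₁       : Fin n
    rest     : List (Fin n)
    len      : suc (length rest) ≡ ℓ
    len≥2    : 2 ≤ ℓ
    distinct : Unique (v₁ ∷ rest)
    path     : PathEdges E (v₁ ∷ rest)
    closing  : E (lastOf v₁ rest) v₁ ≡ true

Acyclic : ∀ {n} → EdgeRel n → Set
Acyclic E = ∀ ℓ → ¬ DirectedCycle E ℓ

Free : ∀ {n} → ℕ → Digraph n → Set
Free r G = ∀ ℓ → ℓ ≤ r → ¬ DirectedCycle (edge G) ℓ

countTrue : List Bool → ℕ
countTrue []          = 0
countTrue (true ∷ bs) = suc (countTrue bs)
countTrue (false ∷ bs) = countTrue bs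

numEdges : ∀ {n} → EdgeRel n → ℕ
numEdges {n} E = countTrue (Data.List.concatMap (λ u → Data.List.map (λ v → E u v) (allFin n)) (allFin n))
  where import Data.List

_⊆E_ : ∀ {n} → EdgeRel n → EdgeRel n → Set
F ⊆E E = ∀ u v → F u v ≡ true → E u v ≡ true

deleteEdges : ∀ {n} → EdgeRel n → EdgeRel n → EdgeRel n
deleteEdges E F u v = E u v ∧ not (F u v)

module Submission where

-- We rank the vertices of every vertex set S so that at most 25|S|²/r² edges inside S point
-- backwards; deleting the backward edges of a ranking of all vertices leaves an acyclic digraph.
-- The ranking is built by induction on |S|.  Pick v ∈ S and let reach i be the vertices with a
-- walk of length ≤ i to v, split into distance layers.  A counting argument gives i < r with
-- r² |layer i| |layer (i+1)| ≤ 50 |S ∩ reach i| |S ∖ reach i|.  If S ∖ reach i is nonempty, rank it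
-- above S ∩ reach i: the new backward edges run from layer i + 1 to layer i, and
-- 25h² + 25l² + 50hl = 25(h + l)².  Otherwise every vertex of S reaches v in fewer than r steps,
-- so by r-freeness v has no out-neighbour in S and can be ranked on top.  The thin layer exists:
-- if every layer were thick, then by AM-GM each pair of layers adds 1 to j in a lower bound
-- 25|S| j² / r² on the size, so the first ⌊r/4⌋ pairs of layers would already hold more than half
-- of S and the last ⌊r/4⌋ pairs more than the other half.

open import Defs
open import Data.Bool using (Bool; true; false; _∧_; _∨_; not; if_then_else_; T)
open import Data.Bool.Properties using (∧-conicalˡ; ∧-conicalʳ; not-involutive; not-injective; ¬-not; not-¬; T-≡)
  renaming (_≟_ to _≟ᵇ_)
open import Data.Bool.ListAction using (any)
open import Data.Nat hiding (_≟_)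
open import Data.Nat.Properties hiding (_≟_)
open import Data.Nat.DivMod using (_/_; _%_; m≡m%n+[m/n]*n; m%n<n)
open import Data.Nat.Induction using (<-rec)
open import Data.Nat.Tactic.RingSolver using (solve-∀)
open import Data.Fin using (Fin; toℕ; fromℕ<)
open import Data.Fin.Properties using (_≟_; any?; toℕ<n; toℕ-fromℕ<)
open import Data.List using (List; []; _∷_; length; allFin; map; concatMap; _++_)
open import Data.List.Properties using (length-tabulate)
open import Data.List.Membership.Propositional using (_∈_; lose)
open import Data.List.Membership.Propositional.Properties using (∈-allFin)
open import Data.List.Relation.Unary.Any using (here; there; satisfied)
open import Data.List.Relation.Unary.Any.Properties using (any⁺; any⁻)
open import Data.List.Relation.Unary.All as All using (All; []; _∷_)
open import Data.List.Relation.Unary.AllPairs using ([]; _∷_)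
open import Data.List.Relation.Unary.Unique.Propositional using (Unique)
open import Data.Empty using (⊥; ⊥-elim)
open import Data.Product using (Σ; ∃; _×_; _,_; proj₁; proj₂)
open import Data.Sum using (inj₁; inj₂)
open import Data.Unit using (tt)
open import Function.Bundles using (Equivalence)
open import Relation.Nullary using (yes; no; does)
open import Relation.Nullary.Decidable using (dec-true)
open import Relation.Binary.PropositionalEquality using (_≡_; _≢_; refl; sym; trans; cong; cong₂; subst; subst₂)
open ≤-Reasoning

private
  2mn≤m*m+n*n-ordered : ∀ {m n} → m ≤ n → 2 * (m * n) ≤ m * m + n * n
  2mn≤m*m+n*n-ordered {m} m≤n with m≤n⇒∃[o]m+o≡n m≤n
  ... | d , refl = ≤-trans (m≤m+n _ (d * d)) (≤-reflexive (square-identity m d))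
    where
    square-identity : ∀ m d → 2 * (m * (m + d)) + d * d ≡ m * m + (m + d) * (m + d)
    square-identity = solve-∀

2mn≤m*m+n*n : ∀ m n → 2 * (m * n) ≤ m * m + n * n
2mn≤m*m+n*n m n with ≤-total m n
... | inj₁ m≤n = 2mn≤m*m+n*n-ordered m≤n
... | inj₂ n≤m = subst₂ _≤_ (cong (2 *_) (*-comm n m)) (+-comm (n * n) (m * m)) (2mn≤m*m+n*n-ordered n≤m)

-- Bounds s times the cross term 2 C j of C (j + 1)², via AM-GM on R s and C j.
cross-term-bound : ∀ R C j a s .{{_ : NonZero R}} → C * (j * j) ≤ R * a →
                   2 * (s * (C * j)) ≤ R * (s * s) + C * a
cross-term-bound R C j a s Cj²≤Ra = *-cancelˡ-≤ R (begin
  R * (2 * (s * (C * j)))               ≡⟨ e₁ R s C j ⟩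
  2 * ((R * s) * (C * j))               ≤⟨ 2mn≤m*m+n*n (R * s) (C * j) ⟩
  (R * s) * (R * s) + (C * j) * (C * j) ≡⟨ cong ((R * s) * (R * s) +_) (e₂ C j) ⟩
  (R * s) * (R * s) + C * (C * (j * j)) ≤⟨ +-monoʳ-≤ ((R * s) * (R * s)) (*-monoʳ-≤ C Cj²≤Ra) ⟩
  (R * s) * (R * s) + C * (R * a)       ≡⟨ e₃ R s C a ⟩
  R * (R * (s * s) + C * a)             ∎)
  where
  e₁ : ∀ R s C j → R * (2 * (s * (C * j))) ≡ 2 * ((R * s) * (C * j))
  e₁ = solve-∀
  e₂ : ∀ C j → (C * j) * (C * j) ≡ C * (C * (j * j))
  e₂ = solve-∀
  e₃ : ∀ R s C a → (R * s) * (R * s) + C * (R * a) ≡ R * (R * (s * s) + C * a)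
  e₃ = solve-∀

square-growth : ∀ R C j a s s′ → C * (j * j) ≤ R * a → C * (a + s) < R * (s * s′) →
                C * (suc j * suc j) < R * (a + s + s′)
square-growth R C j a zero s′ _ C[a+0]<R*0 = ⊥-elim (n≮0 (subst (C * (a + 0) <_) (*-zeroʳ R) C[a+0]<R*0))
square-growth zero C j a (suc _) s′ _ ()
square-growth R@(suc _) C j a s@(suc _) s′ Cj²≤Ra C[a+s]<Rss′ = *-cancelˡ-< s _ _ (begin-strict
  s * (C * (suc j * suc j))                            ≡⟨ e₁ s C j ⟩
  s * (C * (j * j)) + (2 * (s * (C * j)) + C * s)      ≤⟨ +-mono-≤ (*-monoʳ-≤ s Cj²≤Ra)
                                                            (+-monoˡ-≤ (C * s) (cross-term-bound R C j a s Cj²≤Ra)) ⟩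
  s * (R * a) + ((R * (s * s) + C * a) + C * s)        ≡⟨ e₂ s R a C ⟩
  s * (R * a) + R * (s * s) + C * (a + s)              <⟨ +-monoʳ-< (s * (R * a) + R * (s * s)) C[a+s]<Rss′ ⟩
  s * (R * a) + R * (s * s) + R * (s * s′)             ≡⟨ e₃ s R a s′ ⟩
  s * (R * (a + s + s′))                               ∎)
  where
  e₁ : ∀ s C j → s * (C * (suc j * suc j)) ≡ s * (C * (j * j)) + (2 * (s * (C * j)) + C * s)
  e₁ = solve-∀
  e₂ : ∀ s R a C → s * (R * a) + ((R * (s * s) + C * a) + C * s) ≡ s * (R * a) + R * (s * s) + C * (a + s)
  e₂ = solve-∀
  e₃ : ∀ s R a s′ → s * (R * a) + R * (s * s) + R * (s * s′) ≡ s * (R * (a + s + s′))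
  e₃ = solve-∀

25Nx≤50xy : ∀ {x y N} → x + y ≡ N → x ≤ y → 25 * N * x ≤ 50 * (x * y)
25Nx≤50xy {x} {y} refl x≤y = begin
  25 * (x + y) * x ≤⟨ *-monoˡ-≤ x (*-monoʳ-≤ 25 (+-monoˡ-≤ y x≤y)) ⟩
  25 * (y + y) * x ≡⟨ e x y ⟩
  50 * (x * y)     ∎
  where
  e : ∀ x y → 25 * (y + y) * x ≡ 50 * (x * y)
  e = solve-∀

N<2x⇒y<x : ∀ {x y N} → x + y ≡ N → N < 2 * x → y < x
N<2x⇒y<x {x} {y} refl N<2x = +-cancelˡ-< x y x (subst (x + y <_) (cong (x +_) (+-identityʳ x)) N<2x)

[t+4J]²≤50J² : ∀ t p → t < 4 → (t + suc p * 4) * (t + suc p * 4) ≤ 50 * (suc p * suc p)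
[t+4J]²≤50J² t p t<4 = begin
  (t + J * 4) * (t + J * 4)                                ≤⟨ *-mono-≤ t+4J≤3+4J t+4J≤3+4J ⟩
  (3 + J * 4) * (3 + J * 4)                                ≤⟨ m≤m+n _ (34 * (p * p) + 44 * p + 1) ⟩
  (3 + J * 4) * (3 + J * 4) + (34 * (p * p) + 44 * p + 1)  ≡⟨ e p ⟩
  50 * (J * J)                                             ∎
  where
  J = suc p
  t+4J≤3+4J : t + J * 4 ≤ 3 + J * 4
  t+4J≤3+4J = +-monoˡ-≤ (J * 4) (≤-pred t<4)
  e : ∀ p → (3 + suc p * 4) * (3 + suc p * 4) + (34 * (p * p) + 44 * p + 1) ≡ 50 * (suc p * suc p)
  e = solve-∀

-- a i counts the first i + 1 layers (of sizes s 0, s 1, …) of a set of size N, and b i the rest.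
module ThinLayer (N : ℕ) (a b s : ℕ → ℕ)
  (s₀≤a₀ : s 0 ≤ a 0)
  (a-suc : ∀ i → a (suc i) ≡ a i + s (suc i))
  (a+b≡N : ∀ i → a i + b i ≡ N) where

  Thin : ℕ → ℕ → Set
  Thin r i = r * r * (s i * s (suc i)) ≤ 50 * (a i * b i)

  private
    b-suc : ∀ i → b (suc i) + s (suc i) ≡ b i
    b-suc i = +-cancelˡ-≡ (a i) _ _ (begin-equality
      a i + (b (suc i) + s (suc i)) ≡⟨ e (a i) (b (suc i)) (s (suc i)) ⟩
      (a i + s (suc i)) + b (suc i) ≡⟨ cong (_+ b (suc i)) (a-suc i) ⟨
      a (suc i) + b (suc i)         ≡⟨ a+b≡N (suc i) ⟩
      N                             ≡⟨ a+b≡N i ⟨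
      a i + b i                     ∎)
      where
      e : ∀ x y z → x + (y + z) ≡ (x + z) + y
      e = solve-∀

    a-mono : ∀ {i j} → i ≤ j → a i ≤ a j
    a-mono {j = zero} z≤n = ≤-refl
    a-mono {j = suc j} i≤1+j with m≤n⇒m<n∨m≡n i≤1+j
    ... | inj₁ i<1+j = ≤-trans (a-mono (≤-pred i<1+j)) (subst (a j ≤_) (sym (a-suc j)) (m≤m+n _ _))
    ... | inj₂ refl  = ≤-refl

    b-antitone : ∀ {i j} → i ≤ j → b j ≤ b i
    b-antitone {j = zero} z≤n = ≤-refl
    b-antitone {j = suc j} i≤1+j with m≤n⇒m<n∨m≡n i≤1+j
    ... | inj₁ i<1+j = ≤-trans (subst (b (suc j) ≤_) (b-suc j) (m≤m+n _ _)) (b-antitone (≤-pred i<1+j))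
    ... | inj₂ refl  = ≤-refl

  module _ (r : ℕ) (thick : ∀ i → i < r → 50 * (a i * b i) < r * r * (s i * s (suc i))) where
    private
      R C : ℕ
      R = r * r
      C = 25 * N

      C*0≤ : ∀ x → C * (0 * 0) ≤ R * x
      C*0≤ x = subst (_≤ R * x) (sym (*-zeroʳ C)) z≤n

      double-suc : ∀ j → suc j + suc j ≡ suc (suc (j + j))
      double-suc j = cong suc (+-suc j j)

      lower-step : ∀ j → suc j + suc j ≤ r → a (suc (j + j)) ≤ b (suc (j + j)) →
                   C * (j * j) ≤ R * a (j + j) → C * (suc j * suc j) < R * a (suc j + suc j)
      lower-step j 2j+2≤r a≤b Cj²≤Ra = begin-strict
        C * (suc j * suc j)                          <⟨ square-growth R C j _ _ _ Cj²≤Ra thick-at ⟩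
        R * (a (j + j) + s i + s (suc i))            ≡⟨ cong (λ x → R * (x + s (suc i))) (a-suc (j + j)) ⟨
        R * (a i + s (suc i))                        ≡⟨ cong (R *_) (a-suc i) ⟨
        R * a (suc i)                                ≡⟨ cong (λ k → R * a k) (double-suc j) ⟨
        R * a (suc j + suc j)                        ∎
        where
        i = suc (j + j)
        thick-at : C * (a (j + j) + s i) < R * (s i * s (suc i))
        thick-at = begin-strict
          C * (a (j + j) + s i) ≡⟨ cong (C *_) (a-suc (j + j)) ⟨
          C * a i               ≤⟨ 25Nx≤50xy (a+b≡N i) a≤b ⟩
          50 * (a i * b i)      <⟨ thick i (subst (_≤ r) (double-suc j) 2j+2≤r) ⟩
          R * (s i * s (suc i)) ∎

      lower-growth : ∀ j → suc j + suc j ≤ r → (∀ i → i < suc j + suc j → a i ≤ b i) →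
                     C * (suc j * suc j) < R * a (suc j + suc j)
      lower-growth zero ≤r low = lower-step 0 ≤r (low 1 ≤-refl) (C*0≤ (a 0))
      lower-growth (suc j) ≤r low =
        lower-step (suc j) ≤r
          (low (suc (suc j + suc j)) (subst (suc (suc j + suc j) <_) (sym (double-suc (suc j))) (n<1+n _)))
          (<⇒≤ (lower-growth j (≤-trans grows ≤r) (λ i lt → low i (<-≤-trans lt grows))))
        where
        grows : suc j + suc j ≤ suc (suc j) + suc (suc j)
        grows = +-mono-≤ (n≤1+n (suc j)) (n≤1+n (suc j))

      upper-step : ∀ j k → suc k < r → b (suc k) ≤ a (suc k) →
                   C * (j * j) ≤ R * b (suc (suc k)) → C * (suc j * suc j) < R * b k
      upper-step j k k+1<r b≤a Cj²≤Rb = begin-strict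
        C * (suc j * suc j)                                  <⟨ square-growth R C j _ _ _ Cj²≤Rb thick-at ⟩
        R * (b (suc (suc k)) + s (suc (suc k)) + s (suc k))  ≡⟨ cong (λ x → R * (x + s (suc k))) (b-suc (suc k)) ⟩
        R * (b (suc k) + s (suc k))                          ≡⟨ cong (R *_) (b-suc k) ⟩
        R * b k                                              ∎
        where
        i = suc k
        thick-at : C * (b (suc i) + s (suc i)) < R * (s (suc i) * s i)
        thick-at = begin-strict
          C * (b (suc i) + s (suc i)) ≡⟨ cong (C *_) (b-suc i) ⟩
          C * b i                     ≤⟨ 25Nx≤50xy (trans (+-comm (b i) (a i)) (a+b≡N i)) b≤a ⟩
          50 * (b i * a i)            ≡⟨ cong (50 *_) (*-comm (b i) (a i)) ⟩
          50 * (a i * b i)            <⟨ thick i k+1<r ⟩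
          R * (s i * s (suc i))       ≡⟨ cong (R *_) (*-comm (s i) (s (suc i))) ⟩
          R * (s (suc i) * s i)       ∎

      k+1<r : ∀ j k → k + (suc j + suc j) ≤ r → suc k < r
      k+1<r j k ≤r = ≤-trans (≤-trans (≤-reflexive (+-comm 2 k)) (+-monoʳ-≤ k 2≤2j+2)) ≤r
        where
        2≤2j+2 : 2 ≤ suc j + suc j
        2≤2j+2 = s≤s (≤-trans (s≤s z≤n) (m≤n+m (suc j) j))

      upper-growth : ∀ j k → k + (suc j + suc j) ≤ r → (∀ i → k < i → b i ≤ a i) →
                     C * (suc j * suc j) < R * b k
      upper-growth zero k ≤r up = upper-step 0 k (k+1<r 0 k ≤r) (up (suc k) ≤-refl) (C*0≤ (b (suc (suc k))))
      upper-growth (suc j) k ≤r up =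
        upper-step (suc j) k (k+1<r (suc j) k ≤r) (up (suc k) ≤-refl)
          (<⇒≤ (upper-growth j (suc (suc k)) (subst (_≤ r) (e k j) ≤r)
                  (λ i k+2<i → up i (<-trans (n<1+n k) (<-trans (n<1+n (suc k)) k+2<i)))))
        where
        e : ∀ k j → k + (suc (suc j) + suc (suc j)) ≡ suc (suc k) + (suc j + suc j)
        e = solve-∀

      N<2x : ∀ {K x} → R * N ≤ 2 * K → K < R * x → N < 2 * x
      N<2x {K} {x} RN≤2K K<Rx = *-cancelˡ-< R N (2 * x) (begin-strict
        R * N       ≤⟨ RN≤2K ⟩
        2 * K       <⟨ *-monoʳ-< 2 K<Rx ⟩
        2 * (R * x) ≡⟨ e R x ⟩
        R * (2 * x) ∎)
        where
        e : ∀ R x → 2 * (R * x) ≡ R * (2 * x)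
        e = solve-∀

      above-half : ∀ p → suc p + suc p ≤ r → R * N ≤ 2 * (C * (suc p * suc p)) →
                   b (suc p + suc p) < a (suc p + suc p)
      above-half p ≤r RN≤ with a (suc (p + p)) ≤? b (suc (p + p))
      ... | no a≰b = begin-strict
        b (suc p + suc p)  ≤⟨ b-antitone i≤m ⟩
        b (suc (p + p))    <⟨ ≰⇒> a≰b ⟩
        a (suc (p + p))    ≤⟨ a-mono i≤m ⟩
        a (suc p + suc p)  ∎
        where
        i≤m : suc (p + p) ≤ suc p + suc p
        i≤m = s≤s (+-monoʳ-≤ p (n≤1+n p))
      ... | yes a≤b = N<2x⇒y<x (a+b≡N _) (N<2x RN≤ (lower-growth p ≤r below))
        where
        below : ∀ i → i < suc p + suc p → a i ≤ b i
        below i i<m = ≤-trans (a-mono i≤) (≤-trans a≤b (b-antitone i≤))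
          where
          i≤ : i ≤ suc (p + p)
          i≤ = subst (i ≤_) (+-suc p p) (≤-pred i<m)

      below-half : ∀ p k → k + (suc p + suc p) ≤ r → R * N ≤ 2 * (C * (suc p * suc p)) → a k < b k
      below-half p k ≤r RN≤ with b (suc k) ≤? a (suc k)
      ... | no b≰a = begin-strict
        a k       ≤⟨ a-mono (n≤1+n k) ⟩
        a (suc k) <⟨ ≰⇒> b≰a ⟩
        b (suc k) ≤⟨ b-antitone (n≤1+n k) ⟩
        b k       ∎
      ... | yes b≤a = N<2x⇒y<x (trans (+-comm (b k) (a k)) (a+b≡N k)) (N<2x RN≤ (upper-growth p k ≤r above))
        where
        above : ∀ i → k < i → b i ≤ a i
        above i k<i = ≤-trans (b-antitone k<i) (≤-trans b≤a (a-mono k<i))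

      r≤3⇒absurd : 0 < r → r ≤ 3 → ⊥
      r≤3⇒absurd 0<r r≤3 = <⇒≱ (thick 0 0<r) (begin
        R * (s 0 * s 1)   ≤⟨ *-mono-≤ (*-mono-≤ r≤3 r≤3) (*-mono-≤ s₀≤a₀ s₁≤b₀) ⟩
        9 * (a 0 * b 0)   ≤⟨ *-monoˡ-≤ (a 0 * b 0) (m≤m+n 9 41) ⟩
        50 * (a 0 * b 0)  ∎)
        where
        s₁≤b₀ : s 1 ≤ b 0
        s₁≤b₀ = subst (s 1 ≤_) (b-suc 0) (m≤n+m (s 1) (b 1))

    -- Write r = t + 4J: the first 2J layers push a above N/2, the last 2J push b above N/2.
    thick-absurd : 2 ≤ r → ⊥
    thick-absurd 2≤r with r / 4 | m≡m%n+[m/n]*n r 4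
    ... | zero  | r≡t = r≤3⇒absurd (≤-trans (s≤s z≤n) 2≤r)
                           (subst (_≤ 3) (sym (trans r≡t (+-identityʳ _))) (≤-pred (m%n<n r 4)))
    ... | suc p | r≡t+J*4 = <-irrefl refl (begin-strict
      b m ≤⟨ <⇒≤ (above-half p (≤-trans (m≤n+m m k) (≤-reflexive k+m≡r)) RN≤) ⟩
      a m ≤⟨ a-mono (m≤n+m m t) ⟩
      a k <⟨ below-half p k (≤-reflexive k+m≡r) RN≤ ⟩
      b k ≤⟨ b-antitone (m≤n+m m t) ⟩
      b m ∎)
      where
      t = r % 4
      J = suc p
      m = J + J
      k = t + m
      k+m≡r : k + m ≡ r
      k+m≡r = trans (e t p) (sym r≡t+J*4)
        where
        e : ∀ t p → t + (suc p + suc p) + (suc p + suc p) ≡ t + suc p * 4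
        e = solve-∀
      r*r≤50J² : r * r ≤ 50 * (J * J)
      r*r≤50J² = subst (λ x → x * x ≤ 50 * (J * J)) (sym r≡t+J*4) ([t+4J]²≤50J² t p (m%n<n r 4))
      RN≤ : R * N ≤ 2 * (C * (J * J))
      RN≤ = begin
        R * N                ≤⟨ *-monoˡ-≤ N r*r≤50J² ⟩
        50 * (J * J) * N     ≡⟨ e (J * J) N ⟩
        2 * (C * (J * J))    ∎
        where
        e : ∀ x N → 50 * x * N ≡ 2 * (25 * N * x)
        e = solve-∀

  thin-layer : ∀ r → 2 ≤ r → ∃ λ i → i < r × Thin r i
  thin-layer r 2≤r with any? (λ (i : Fin r) → r * r * (s (toℕ i) * s (suc (toℕ i)))
                                                ≤? 50 * (a (toℕ i) * b (toℕ i)))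
  ... | yes (i , thin) = toℕ i , toℕ<n i , thin
  ... | no ¬thin = ⊥-elim (thick-absurd r thick 2≤r)
    where
    thick : ∀ i → i < r → 50 * (a i * b i) < r * r * (s i * s (suc i))
    thick i i<r = ≰⇒> λ thin → ¬thin (fromℕ< i<r , subst (Thin r) (sym (toℕ-fromℕ< i<r)) thin)

𝟙 : Bool → ℕ
𝟙 true  = 1
𝟙 false = 0

𝟙≤1 : ∀ b → 𝟙 b ≤ 1
𝟙≤1 true  = ≤-refl
𝟙≤1 false = z≤n

𝟙-≡0 : ∀ {a} → a ≢ true → 𝟙 a ≡ 0
𝟙-≡0 {a} a≢true rewrite ¬-not a≢true = refl

𝟙-≤-* : ∀ {a b c} → (a ≡ true → b ≡ true × c ≡ true) → 𝟙 a ≤ 𝟙 b * 𝟙 c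
𝟙-≤-* {false} _ = z≤n
𝟙-≤-* {true}  a⇒bc with a⇒bc refl
... | refl , refl = ≤-refl

∑ : {A : Set} → List A → (A → ℕ) → ℕ
∑ []       f = 0
∑ (x ∷ xs) f = f x + ∑ xs f

module _ {A : Set} where

  ∑-cong : ∀ xs {f g : A → ℕ} → (∀ x → f x ≡ g x) → ∑ xs f ≡ ∑ xs g
  ∑-cong []       f≡g = refl
  ∑-cong (x ∷ xs) f≡g = cong₂ _+_ (f≡g x) (∑-cong xs f≡g)

  ∑-mono-≤ : ∀ xs {f g : A → ℕ} → (∀ x → f x ≤ g x) → ∑ xs f ≤ ∑ xs g
  ∑-mono-≤ []       f≤g = z≤n
  ∑-mono-≤ (x ∷ xs) f≤g = +-mono-≤ (f≤g x) (∑-mono-≤ xs f≤g)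

  ∑-zero : ∀ xs {f : A → ℕ} → (∀ x → f x ≡ 0) → ∑ xs f ≡ 0
  ∑-zero []       f≡0 = refl
  ∑-zero (x ∷ xs) f≡0 = cong₂ _+_ (f≡0 x) (∑-zero xs f≡0)

  ∈⇒≤∑ : ∀ {xs x} (f : A → ℕ) → x ∈ xs → f x ≤ ∑ xs f
  ∈⇒≤∑ {y ∷ xs} f (here refl) = m≤m+n (f y) _
  ∈⇒≤∑ {y ∷ xs} f (there x∈xs) = ≤-trans (∈⇒≤∑ f x∈xs) (m≤n+m _ (f y))

  ∑-distrib-+ : ∀ xs (f g : A → ℕ) → ∑ xs (λ x → f x + g x) ≡ ∑ xs f + ∑ xs g
  ∑-distrib-+ []       f g = refl
  ∑-distrib-+ (x ∷ xs) f g = trans (cong (f x + g x +_) (∑-distrib-+ xs f g)) (e (f x) (g x) _ _)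
    where
    e : ∀ a b c d → a + b + (c + d) ≡ a + c + (b + d)
    e = solve-∀

  ∑-distribˡ-* : ∀ xs c (f : A → ℕ) → ∑ xs (λ x → c * f x) ≡ c * ∑ xs f
  ∑-distribˡ-* []       c f = sym (*-zeroʳ c)
  ∑-distribˡ-* (x ∷ xs) c f = trans (cong (c * f x +_) (∑-distribˡ-* xs c f)) (sym (*-distribˡ-+ c (f x) _))

  ∑-≤-+₃ : ∀ xs {f g h k : A → ℕ} → (∀ x → f x ≤ g x + h x + k x) → ∑ xs f ≤ ∑ xs g + ∑ xs h + ∑ xs k
  ∑-≤-+₃ []       _ = z≤n
  ∑-≤-+₃ (x ∷ xs) {f} {g} {h} {k} f≤ = ≤-trans (+-mono-≤ (f≤ x) (∑-≤-+₃ xs f≤))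
    (≤-reflexive (e (g x) (h x) (k x) (∑ xs g) (∑ xs h) (∑ xs k)))
    where
    e : ∀ a b c A B C → a + b + c + (A + B + C) ≡ a + A + (b + B) + (c + C)
    e = solve-∀

∑-*-∑ : ∀ {A B : Set} (xs : List A) (ys : List B) f g →
        ∑ xs (λ x → ∑ ys (λ y → f x * g y)) ≡ ∑ xs f * ∑ ys g
∑-*-∑ []       ys f g = refl
∑-*-∑ (x ∷ xs) ys f g = begin-equality
  ∑ ys (λ y → f x * g y) + ∑ xs (λ x → ∑ ys (λ y → f x * g y))
    ≡⟨ cong₂ _+_ (∑-distribˡ-* ys (f x) g) (∑-*-∑ xs ys f g) ⟩
  f x * ∑ ys g + ∑ xs f * ∑ ys g
    ≡⟨ *-distribʳ-+ (∑ ys g) (f x) _ ⟨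
  (f x + ∑ xs f) * ∑ ys g
    ∎

VertexSet : ℕ → Set
VertexSet n = Fin n → Bool

module _ {n : ℕ} where

  ∣_∣ : VertexSet n → ℕ
  ∣ S ∣ = ∑ (allFin n) (λ u → 𝟙 (S u))

  _∩_ _∖_ : VertexSet n → VertexSet n → VertexSet n
  (S ∩ P) u = S u ∧ P u
  (S ∖ P) u = S u ∧ not (P u)

  ∣∣-cong : ∀ {S T} → (∀ u → S u ≡ T u) → ∣ S ∣ ≡ ∣ T ∣
  ∣∣-cong S≡T = ∑-cong (allFin n) (λ u → cong 𝟙 (S≡T u))

  ∈⇒1≤∣∣ : ∀ {S u} → S u ≡ true → 1 ≤ ∣ S ∣
  ∈⇒1≤∣∣ {S} {u} Su = subst (_≤ ∣ S ∣) (cong 𝟙 Su) (∈⇒≤∑ (λ u → 𝟙 (S u)) (∈-allFin u))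

  ∣∣≡0⇒∉ : ∀ {S} → ∣ S ∣ ≡ 0 → ∀ u → S u ≡ false
  ∣∣≡0⇒∉ {S} ∣S∣≡0 u = ¬-not λ Su → 1+n≰n (subst (1 ≤_) ∣S∣≡0 (∈⇒1≤∣∣ {S} Su))

  ∣∩∣+∣∖∣ : ∀ S P → ∣ S ∩ P ∣ + ∣ S ∖ P ∣ ≡ ∣ S ∣
  ∣∩∣+∣∖∣ S P = trans (sym (∑-distrib-+ (allFin n) _ _)) (∑-cong (allFin n) (λ u → split (S u) (P u)))
    where
    split : ∀ s p → 𝟙 (s ∧ p) + 𝟙 (s ∧ not p) ≡ 𝟙 s
    split true  true  = refl
    split true  false = refl
    split false _     = refl

  ∣∩∣-⊆ : ∀ S {P Q} → (∀ u → P u ≡ true → Q u ≡ true) → ∣ S ∩ Q ∣ ≡ ∣ S ∩ P ∣ + ∣ S ∩ (Q ∖ P) ∣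
  ∣∩∣-⊆ S {P} {Q} P⊆Q =
    trans (∑-cong (allFin n) (λ u → split (S u) (P u) (Q u) (P⊆Q u))) (∑-distrib-+ (allFin n) _ _)
    where
    split : ∀ s p q → (p ≡ true → q ≡ true) → 𝟙 (s ∧ q) ≡ 𝟙 (s ∧ p) + 𝟙 (s ∧ (q ∧ not p))
    split false _     _     _   = refl
    split true  false false _   = refl
    split true  false true  _   = refl
    split true  true  q     p⇒q rewrite p⇒q refl = refl

  ∣∖∣<∣∣ : ∀ S P → 1 ≤ ∣ S ∩ P ∣ → ∣ S ∖ P ∣ < ∣ S ∣
  ∣∖∣<∣∣ S P 1≤∣S∩P∣ =
    subst (∣ S ∖ P ∣ <_) (trans (+-comm ∣ S ∖ P ∣ ∣ S ∩ P ∣) (∣∩∣+∣∖∣ S P)) (m<m+n ∣ S ∖ P ∣ 1≤∣S∩P∣)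

  ∣∩∣<∣∣ : ∀ S P → 1 ≤ ∣ S ∖ P ∣ → ∣ S ∩ P ∣ < ∣ S ∣
  ∣∩∣<∣∣ S P 1≤∣S∖P∣ = subst (∣ S ∩ P ∣ <_) (∣∩∣+∣∖∣ S P) (m<m+n ∣ S ∩ P ∣ 1≤∣S∖P∣)

≤ᵇ≡true⇒≤ : ∀ {m n} → (m ≤ᵇ n) ≡ true → m ≤ n
≤ᵇ≡true⇒≤ {m} {n} m≤ᵇn = ≤ᵇ⇒≤ m n (Equivalence.from T-≡ m≤ᵇn)

+-≤ᵇ : ∀ k m n → (k + m ≤ᵇ k + n) ≡ (m ≤ᵇ n)
+-≤ᵇ zero    m n = refl
+-≤ᵇ (suc k) m n = trans (suc-≤ᵇ (k + m) (k + n)) (+-≤ᵇ k m n)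
  where
  suc-≤ᵇ : ∀ m n → (suc m ≤ᵇ suc n) ≡ (m ≤ᵇ n)
  suc-≤ᵇ zero    n = refl
  suc-≤ᵇ (suc m) n = refl

25[h+l]²-bound : ∀ {B BH BL X K h l} → B ≤ BH + BL + X →
  BH * K ≤ 25 * (h * h) → BL * K ≤ 25 * (l * l) → X * K ≤ 50 * (h * l) →
  B * K ≤ 25 * ((h + l) * (h + l))
25[h+l]²-bound {B} {BH} {BL} {X} {K} {h} {l} B≤ BH≤ BL≤ X≤ = begin
  B * K                                       ≤⟨ *-monoˡ-≤ K B≤ ⟩
  (BH + BL + X) * K                           ≡⟨ e₁ BH BL X K ⟩
  BH * K + BL * K + X * K                     ≤⟨ +-mono-≤ (+-mono-≤ BH≤ BL≤) X≤ ⟩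
  25 * (h * h) + 25 * (l * l) + 50 * (h * l)  ≡⟨ e₂ h l ⟩
  25 * ((h + l) * (h + l))                    ∎
  where
  e₁ : ∀ a b c d → (a + b + c) * d ≡ a * d + b * d + c * d
  e₁ = solve-∀
  e₂ : ∀ h l → 25 * (h * h) + 25 * (l * l) + 50 * (h * l) ≡ 25 * ((h + l) * (h + l))
  e₂ = solve-∀

≟-sound : ∀ {n} {u v : Fin n} → does (u ≟ v) ≡ true → u ≡ v
≟-sound {u = u} {v} _ with u ≟ v
≟-sound _  | yes u≡v = u≡v
≟-sound () | no _

module Ranking {n : ℕ} (E : EdgeRel n) where

  backward : VertexSet n → (Fin n → ℕ) → ℕ
  backward S ρ = ∑ (allFin n) λ u → ∑ (allFin n) λ w → 𝟙 (S u ∧ (S w ∧ (E u w ∧ (ρ w ≤ᵇ ρ u))))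

  cross : VertexSet n → VertexSet n → ℕ
  cross H L = ∑ (allFin n) λ u → ∑ (allFin n) λ w → 𝟙 (H u ∧ (E u w ∧ L w))

  -- K stands for r², so that β ≤ 25 |S|² / r² is stated without division.
  Rankable : ℕ → VertexSet n → Set
  Rankable K S = Σ (Fin n → ℕ) λ ρ → backward S ρ * K ≤ 25 * (∣ S ∣ * ∣ S ∣)

  -- Shifting ρH above every value of ρL makes all edges from S ∖ P into S ∩ P forward.
  stack : VertexSet n → (Fin n → ℕ) → (Fin n → ℕ) → Fin n → ℕ
  stack P ρH ρL u = if P u then suc (∑ (allFin n) ρL) + ρH u else ρL u

  private
    stack-case : ∀ M (p q : Bool) x y x′ y′ → x′ < M →
      𝟙 ((if q then M + y else y′) ≤ᵇ (if p then M + x else x′))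
        ≤ 𝟙 (p ∧ (q ∧ (y ≤ᵇ x))) + 𝟙 (not p ∧ (not q ∧ (y′ ≤ᵇ x′))) + 𝟙 (p ∧ not q)
    stack-case M true  true  x y x′ y′ _ =
      ≤-trans (≤-reflexive (cong 𝟙 (+-≤ᵇ M y x))) (≤-trans (m≤m+n _ 0) (m≤m+n _ 0))
    stack-case M true  false x y x′ y′ _ = 𝟙≤1 (y′ ≤ᵇ M + x)
    stack-case M false true  x y x′ y′ x′<M =
      ≤-reflexive (𝟙-≡0 λ M+y≤x′ → <⇒≱ x′<M (≤-trans (m≤m+n M y) (≤ᵇ≡true⇒≤ M+y≤x′)))
    stack-case M false false x y x′ y′ _ = m≤m+n _ 0

  backward-stack : ∀ S P ρH ρL → backward S (stack P ρH ρL) ≤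
    backward (S ∩ P) ρH + backward (S ∖ P) ρL + cross (S ∩ P) (S ∖ P)
  backward-stack S P ρH ρL = ∑-≤-+₃ (allFin n) (λ u → ∑-≤-+₃ (allFin n) (pair u))
    where
    ρ = stack P ρH ρL
    pair : ∀ u w → 𝟙 (S u ∧ (S w ∧ (E u w ∧ (ρ w ≤ᵇ ρ u)))) ≤
      𝟙 ((S u ∧ P u) ∧ ((S w ∧ P w) ∧ (E u w ∧ (ρH w ≤ᵇ ρH u)))) +
      𝟙 ((S u ∧ not (P u)) ∧ ((S w ∧ not (P w)) ∧ (E u w ∧ (ρL w ≤ᵇ ρL u)))) +
      𝟙 ((S u ∧ P u) ∧ (E u w ∧ (S w ∧ not (P w))))
    pair u w with S u | S w | E u w
    ... | false | _     | _     = z≤n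
    ... | true  | false | _     = z≤n
    ... | true  | true  | false = z≤n
    ... | true  | true  | true  =
      stack-case _ (P u) (P w) (ρH u) (ρH w) (ρL u) (ρL w) (s≤s (∈⇒≤∑ ρL (∈-allFin u)))

  rankable-split : ∀ K S P → Rankable K (S ∩ P) → Rankable K (S ∖ P) →
    cross (S ∩ P) (S ∖ P) * K ≤ 50 * (∣ S ∩ P ∣ * ∣ S ∖ P ∣) → Rankable K S
  rankable-split K S P (ρH , H≤) (ρL , L≤) X≤ =
    stack P ρH ρL ,
    subst (λ N → backward S (stack P ρH ρL) * K ≤ 25 * (N * N)) (∣∩∣+∣∖∣ S P)
      (25[h+l]²-bound {BH = backward (S ∩ P) ρH} {BL = backward (S ∖ P) ρL}
                      {X = cross (S ∩ P) (S ∖ P)} {h = ∣ S ∩ P ∣} {l = ∣ S ∖ P ∣}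
                      (backward-stack S P ρH ρL) H≤ L≤ X≤)

  no-backward⇒rankable : ∀ K S {ρ} → backward S ρ ≡ 0 → Rankable K S
  no-backward⇒rankable K S {ρ} B≡0 = ρ , subst (λ B → B * K ≤ 25 * (∣ S ∣ * ∣ S ∣)) (sym B≡0) z≤n

  rankable-empty : ∀ K S → (∀ u → S u ≡ false) → Rankable K S
  rankable-empty K S S≡∅ = no-backward⇒rankable K S {λ _ → 0}
    (∑-zero (allFin n) λ u → ∑-zero (allFin n) λ w → cong (λ s → 𝟙 (s ∧ (S w ∧ (E u w ∧ true)))) (S≡∅ u))

  rankable-point : ∀ K S v → E v v ≡ false → Rankable K (S ∩ λ u → does (u ≟ v))
  rankable-point K S v Evv = no-backward⇒rankable K _ {λ _ → 0}
    (∑-zero (allFin n) λ u → ∑-zero (allFin n) λ w → 𝟙-≡0 λ h →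
      let Pu   = ∧-conicalʳ (S u) _ (∧-conicalˡ (S u ∧ does (u ≟ v)) _ h)
          PwE  = ∧-conicalʳ (S u ∧ does (u ≟ v)) _ h
          Pw   = ∧-conicalʳ (S w) _ (∧-conicalˡ (S w ∧ does (w ≟ v)) _ PwE)
          Euw  = ∧-conicalˡ (E u w) _ (∧-conicalʳ (S w ∧ does (w ≟ v)) _ PwE)
      in not-¬ (subst₂ (λ x y → E x y ≡ true) (≟-sound Pu) (≟-sound Pw) Euw) Evv)

module Reach {n : ℕ} (E : EdgeRel n) (v : Fin n) where

  reach : ℕ → VertexSet n
  reach zero    u = does (u ≟ v)
  reach (suc i) u = reach i u ∨ any (λ w → reach i w ∧ E u w) (allFin n)

  layer : ℕ → VertexSet n
  layer zero    = reach zero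
  layer (suc i) = reach (suc i) ∖ reach i

  reach-suc : ∀ i u → reach i u ≡ true → reach (suc i) u ≡ true
  reach-suc i u Ru rewrite Ru = refl

  reach-target : ∀ i → reach i v ≡ true
  reach-target zero    = dec-true (v ≟ v) refl
  reach-target (suc i) = reach-suc i v (reach-target i)

  reach-edge : ∀ i {u w} → E u w ≡ true → reach i w ≡ true → reach (suc i) u ≡ true
  reach-edge i {u} {w} Euw Rw with reach i u
  ... | true  = refl
  ... | false = Equivalence.to T-≡
                  (any⁺ _ (lose (∈-allFin w) (subst T (sym (cong₂ _∧_ Rw Euw)) tt)))

  layer-target : ∀ i {u w} → reach i u ≡ false → E u w ≡ true → reach i w ≡ true → layer i w ≡ true
  layer-target zero    _ _ Rw = Rw
  layer-target (suc i) {u} {w} Ru Euw Rw with reach i w in Riw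
  ... | true  = ⊥-elim (not-¬ (reach-edge i Euw Riw) Ru)
  ... | false = cong (_∧ true) Rw

  record ShortPath (i : ℕ) (u : Fin n) : Set where
    field
      rest     : List (Fin n)
      distinct : Unique (u ∷ rest)
      edges    : PathEdges E (u ∷ rest)
      ends     : lastOf u rest ≡ v
      short    : length rest ≤ i
      inside   : All (λ x → reach i x ≡ true) (u ∷ rest)

  short-path : ∀ i {u} → reach i u ≡ true → ShortPath i u
  short-path zero Ru = record
    { rest = [] ; distinct = [] ∷ [] ; edges = tt ; ends = ≟-sound Ru ; short = z≤n ; inside = Ru ∷ [] }
  short-path (suc i) {u} Ru with reach i u in Riu
  ... | true = record
    { rest = rest ; distinct = distinct ; edges = edges ; ends = ends
    ; short = m≤n⇒m≤1+n short ; inside = All.map (reach-suc i _) inside }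
    where open ShortPath (short-path i Riu)
  ... | false with satisfied (any⁻ _ (allFin n) (Equivalence.from T-≡ Ru))
  ...   | w , Rw∧Euw = record
    { rest = w ∷ rest
    ; distinct = All.map (λ Rx u≡x → not-¬ (subst (λ y → reach i y ≡ true) (sym u≡x) Rx) Riu) inside ∷ distinct
    ; edges = Euw , edges ; ends = ends ; short = s≤s short
    ; inside = reach-edge i Euw Rw ∷ All.map (reach-suc i _) inside }
    where
    Rw  = ∧-conicalˡ (reach i w) _ (Equivalence.to T-≡ Rw∧Euw)
    Euw = ∧-conicalʳ (reach i w) _ (Equivalence.to T-≡ Rw∧Euw)
    open ShortPath (short-path i Rw)

  close-cycle : ∀ {i u} (p : ShortPath i u) → E v u ≡ true → E v v ≡ false →
                DirectedCycle E (suc (length (ShortPath.rest p)))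
  close-cycle {u = u} p Evu Evv = record
    { v₁ = u ; rest = rest ; len = refl ; len≥2 = len≥2 rest ends ; distinct = distinct ; path = edges
    ; closing = subst (λ x → E x u ≡ true) (sym ends) Evu }
    where
    open ShortPath p
    len≥2 : ∀ rest → lastOf u rest ≡ v → 2 ≤ suc (length rest)
    len≥2 []      u≡v = ⊥-elim (not-¬ (subst (λ x → E v x ≡ true) u≡v Evu) Evv)
    len≥2 (_ ∷ _) _   = s≤s (s≤s z≤n)

increasing⇒acyclic : ∀ {n} {D : EdgeRel n} (ρ : Fin n → ℕ) → (∀ u w → D u w ≡ true → ρ u < ρ w) → Acyclic D
increasing⇒acyclic {D = D} ρ increasing ℓ cycle =
  <-irrefl refl (≤-<-trans (along v₁ rest path) (increasing _ _ closing))
  where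
  open DirectedCycle cycle
  along : ∀ x xs → PathEdges D (x ∷ xs) → ρ x ≤ ρ (lastOf x xs)
  along x []       _          = ≤-refl
  along x (y ∷ ys) (Dxy , ps) = ≤-trans (<⇒≤ (increasing x y Dxy)) (along y ys ps)

countTrue-++ : ∀ bs cs → countTrue (bs ++ cs) ≡ countTrue bs + countTrue cs
countTrue-++ []           cs = refl
countTrue-++ (true ∷ bs)  cs = cong suc (countTrue-++ bs cs)
countTrue-++ (false ∷ bs) cs = countTrue-++ bs cs

countTrue-map : ∀ {A : Set} (f : A → Bool) xs → countTrue (map f xs) ≡ ∑ xs (λ x → 𝟙 (f x))
countTrue-map f []       = refl
countTrue-map f (x ∷ xs) with f x
... | true  = cong suc (countTrue-map f xs)
... | false = countTrue-map f xs

countTrue-concatMap : ∀ {A : Set} (g : A → List Bool) xs →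
                      countTrue (concatMap g xs) ≡ ∑ xs (λ x → countTrue (g x))
countTrue-concatMap g []       = refl
countTrue-concatMap g (x ∷ xs) =
  trans (countTrue-++ (g x) _) (cong (countTrue (g x) +_) (countTrue-concatMap g xs))

numEdges≡∑∑ : ∀ {n} (E : EdgeRel n) → numEdges E ≡ ∑ (allFin n) λ u → ∑ (allFin n) λ w → 𝟙 (E u w)
numEdges≡∑∑ {n} E =
  trans (countTrue-concatMap _ (allFin n)) (∑-cong (allFin n) λ u → countTrue-map (E u) (allFin n))

module _ {n : ℕ} (G : Digraph n) (r : ℕ) (2≤r : 2 ≤ r) (free : Free r G) where
  open Ranking (edge G)

  module BreadthFirst (S : VertexSet n) (v : Fin n) (Sv : S v ≡ true)
                      (smaller : ∀ S′ → ∣ S′ ∣ < ∣ S ∣ → Rankable (r * r) S′) where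
    open Reach (edge G) v
    open ThinLayer ∣ S ∣ (λ i → ∣ S ∩ reach i ∣) (λ i → ∣ S ∖ reach i ∣) (λ i → ∣ S ∩ layer i ∣)
                   ≤-refl (λ i → ∣∩∣-⊆ S (reach-suc i)) (λ i → ∣∩∣+∣∖∣ S (reach i))

    cut : ∀ i → Thin r i → 1 ≤ ∣ S ∖ reach i ∣ → Rankable (r * r) S
    cut i thin 1≤∣H∣ = rankable-split (r * r) S P
      (smaller (S ∩ P) (∣∩∣<∣∣ S P (∈⇒1≤∣∣ {S = S ∖ P} v∈L)))
      (smaller (S ∖ P) (∣∖∣<∣∣ S P 1≤∣H∣))
      (begin
        cross (S ∩ P) (S ∖ P) * (r * r)                       ≤⟨ *-monoˡ-≤ (r * r) cross-≤ ⟩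
        ∣ S ∩ layer (suc i) ∣ * ∣ S ∩ layer i ∣ * (r * r)     ≡⟨ e (∣ S ∩ layer (suc i) ∣) _ (r * r) ⟩
        r * r * (∣ S ∩ layer i ∣ * ∣ S ∩ layer (suc i) ∣)     ≤⟨ thin ⟩
        50 * (∣ S ∩ reach i ∣ * ∣ S ∖ reach i ∣)              ≡⟨ cong (50 *_) (*-comm ∣ S ∩ reach i ∣ ∣ S ∖ reach i ∣) ⟩
        50 * (∣ S ∖ reach i ∣ * ∣ S ∩ reach i ∣)              ≡⟨ cong (λ a → 50 * (∣ S ∖ reach i ∣ * a)) ∣L∣≡a ⟨
        50 * (∣ S ∩ P ∣ * ∣ S ∖ P ∣)                          ∎)
      where
      P : VertexSet n
      P u = not (reach i u)
      e : ∀ x y z → x * y * z ≡ z * (y * x)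
      e = solve-∀
      v∈L : (S ∖ P) v ≡ true
      v∈L = cong₂ (λ s x → s ∧ not (not x)) Sv (reach-target i)
      ∣L∣≡a : ∣ S ∖ P ∣ ≡ ∣ S ∩ reach i ∣
      ∣L∣≡a = ∣∣-cong λ u → cong (S u ∧_) (not-involutive (reach i u))
      edge-layers : ∀ u w → (S ∩ P) u ∧ (edge G u w ∧ (S ∖ P) w) ≡ true →
                    (S ∩ layer (suc i)) u ≡ true × (S ∩ layer i) w ≡ true
      edge-layers u w h = cong₂ _∧_ Su (cong₂ _∧_ (reach-edge i Euw Rw) (cong not Ru)) ,
                          cong₂ _∧_ Sw (layer-target i Ru Euw Rw)
        where
        Hu  = ∧-conicalˡ ((S ∩ P) u) _ h
        EL  = ∧-conicalʳ ((S ∩ P) u) _ h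
        Su  = ∧-conicalˡ (S u) _ Hu
        Ru  = not-injective {y = false} (∧-conicalʳ (S u) _ Hu)
        Euw = ∧-conicalˡ (edge G u w) _ EL
        Lw  = ∧-conicalʳ (edge G u w) _ EL
        Sw  = ∧-conicalˡ (S w) _ Lw
        Rw  = trans (sym (not-involutive (reach i w))) (∧-conicalʳ (S w) _ Lw)
      cross-≤ : cross (S ∩ P) (S ∖ P) ≤ ∣ S ∩ layer (suc i) ∣ * ∣ S ∩ layer i ∣
      cross-≤ = ≤-trans (∑-mono-≤ (allFin n) λ u → ∑-mono-≤ (allFin n) λ w → 𝟙-≤-* (edge-layers u w))
                        (≤-reflexive (∑-*-∑ (allFin n) (allFin n) _ _))

    sink : ∀ i → i < r → ∣ S ∖ reach i ∣ ≡ 0 → Rankable (r * r) S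
    sink i i<r ∣H∣≡0 = rankable-split (r * r) S P
      (rankable-point (r * r) S v (noLoop G v))
      (smaller (S ∖ P) (∣∖∣<∣∣ S P (∈⇒1≤∣∣ {S = S ∩ P} (cong₂ _∧_ Sv (dec-true (v ≟ v) refl)))))
      (subst (λ X → X * (r * r) ≤ 50 * (∣ S ∩ P ∣ * ∣ S ∖ P ∣)) (sym no-cross) z≤n)
      where
      P : VertexSet n
      P u = does (u ≟ v)
      S⊆reach : ∀ u → S u ≡ true → reach i u ≡ true
      S⊆reach u Su = not-injective {y = true} (subst (λ s → s ∧ not (reach i u) ≡ false) Su (∣∣≡0⇒∉ ∣H∣≡0 u))
      no-edge-out : ∀ w → S w ≡ true → edge G v w ≡ true → ⊥
      no-edge-out w Sw Evw = free _ (≤-trans (s≤s short) i<r) (close-cycle p Evw (noLoop G v))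
        where
        p = short-path i (S⊆reach w Sw)
        open ShortPath p
      no-cross : cross (S ∩ P) (S ∖ P) ≡ 0
      no-cross = ∑-zero (allFin n) λ u → ∑-zero (allFin n) λ w → 𝟙-≡0 λ h →
        let u≡v = ≟-sound (∧-conicalʳ (S u) _ (∧-conicalˡ ((S ∩ P) u) _ h))
            EL  = ∧-conicalʳ ((S ∩ P) u) _ h
            Euw = ∧-conicalˡ (edge G u w) _ EL
            Sw  = ∧-conicalˡ (S w) _ (∧-conicalʳ (edge G u w) _ EL)
        in no-edge-out w Sw (subst (λ x → edge G x w ≡ true) u≡v Euw)

    rankable-S : Rankable (r * r) S
    rankable-S with thin-layer r 2≤r
    ... | i , i<r , thin with 1 ≤? ∣ S ∖ reach i ∣
    ...   | yes 1≤∣H∣ = cut i thin 1≤∣H∣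
    ...   | no  1≰∣H∣ = sink i i<r (n<1⇒n≡0 (≰⇒> 1≰∣H∣))

  rankable : ∀ S → Rankable (r * r) S
  rankable S = <-rec (λ m → ∀ S → ∣ S ∣ ≡ m → Rankable (r * r) S) step ∣ S ∣ S refl
    where
    step : ∀ m → (∀ {m′} → m′ < m → ∀ S → ∣ S ∣ ≡ m′ → Rankable (r * r) S) → ∀ S → ∣ S ∣ ≡ m → Rankable (r * r) S
    step m ih S refl with any? (λ u → S u ≟ᵇ true)
    ... | yes (v , Sv) = BreadthFirst.rankable-S S v Sv (λ S′ ∣S′∣<∣S∣ → ih ∣S′∣<∣S∣ S′ refl)
    ... | no ∄v          = rankable-empty (r * r) S (λ u → ¬-not λ Su → ∄v (u , Su))

∣all∣≡n : ∀ n → ∣ (λ (_ : Fin n) → true) ∣ ≡ n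
∣all∣≡n n = trans (∑1≡length (allFin n)) (length-tabulate (λ u → u))
  where
  ∑1≡length : ∀ {A : Set} (xs : List A) → ∑ xs (λ _ → 1) ≡ length xs
  ∑1≡length []       = refl
  ∑1≡length (x ∷ xs) = cong suc (∑1≡length xs)

backward-removed : ∀ {n} (E : EdgeRel n) (ρ : Fin n → ℕ) u w →
  deleteEdges E (λ u w → E u w ∧ (ρ w ≤ᵇ ρ u)) u w ≡ true → ρ u < ρ w
backward-removed E ρ u w h = ≰⇒> λ ρw≤ρu →
  not-¬ (cong₂ _∧_ Euw (dec-true (ρ w ≤? ρ u) ρw≤ρu)) (not-injective {y = false} (∧-conicalʳ (E u w) _ h))
  where
  Euw = ∧-conicalˡ (E u w) _ h

corollary1p3 : (r : ℕ) → 2 ≤ r → (n : ℕ) → (G : Digraph n) → Free r G →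
    Σ (EdgeRel n) λ F → (F ⊆E edge G) × (numEdges F * (r * r) ≤ 25 * (n * n)) ×
      Acyclic (deleteEdges (edge G) F)
corollary1p3 r 2≤r n G free =
  F , (λ u w → ∧-conicalˡ (edge G u w) _) ,
  subst₂ (λ m N → m * (r * r) ≤ 25 * (N * N)) (sym (numEdges≡∑∑ F)) (∣all∣≡n n) (proj₂ ranked) ,
  increasing⇒acyclic ρ (backward-removed (edge G) ρ)
  where
  ranked = rankable G r 2≤r free (λ _ → true)
  ρ = proj₁ ranked
  F : EdgeRel n
  F u w = edge G u w ∧ (ρ w ≤ᵇ ρ u)
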